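{- Let $k\in\mathbb{Z}_{\geq 0}$ and $r\in\{0,1,\ldots,5\}$. Every $\lambda\in P(6k+r,3)$ can be written uniquely as $\lambda=\mu+V_3\tau$ with $\mu\in F_3$ and $\tau\in\mathbb{Z}^3_{\geq 0}$, and the map $$\phi_{k,r}: P(6k+r,3)\to Q_{k,r}:=(H_r\times T_k)\cup(H_{6+r}\times T_{k-1})\cup(H_{12+r}\times T_{k-2}),\qquad \lambda\mapsto(\mu,\tau),$$ is a bijection.
   Context: $P(n,3)$ is the set of integer vectors $\lambda=(\lambda_1,\lambda_2,\lambda_3)$ with $\lambda_1+\lambda_2+\lambda_3=n$ and $\lambda_1\ge\lambda_2\ge\lambda_3>0$ (partitions of $n$ into three parts). $V_3$ is the $3\times3$ matrix with rows $(6,3,2),(0,3,2),(0,0,2)$, i.e. with columns $v_1=(6,0,0)$, $v_2=(3,3,0)$, $v_3=(2,2,2)$. The fundamental parallelepiped lattice point set is $F_3=\mathbb{Z}^3\cap\{a v_1+b v_2+c v_3 : a,b\in[0,1),\ c\in(0,1]\}$. For an integer $i$, $H_i=\{\mu\in F_3:\mu_1+\mu_2+\mu_3=i\}$. For an integer $k$, $T_k=\{v\in\mathbb{Z}^3_{\ge0}: v_1+v_2+v_3=k\}$ (empty if $k<0$). -}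

module Defs where

open import Data.Nat as ℕ using (ℕ)
open import Data.Integer as ℤ using (ℤ; +_)
open import Data.Rational as ℚ using (ℚ; 0ℚ; 1ℚ)
open import Data.Product using (Σ; _×_; _,_; ∃)
open import Data.Sum using (_⊎_)
open import Relation.Binary.PropositionalEquality using (_≡_)

Vec3 : Set
Vec3 = ℤ × ℤ × ℤ

_+v_ : Vec3 → Vec3 → Vec3
(a₁ , a₂ , a₃) +v (b₁ , b₂ , b₃) = (a₁ ℤ.+ b₁ , a₂ ℤ.+ b₂ , a₃ ℤ.+ b₃)

dot : Vec3 → Vec3 → ℤ
dot (a₁ , a₂ , a₃) (b₁ , b₂ , b₃) = a₁ ℤ.* b₁ ℤ.+ a₂ ℤ.* b₂ ℤ.+ a₃ ℤ.* b₃

sum3 : Vec3 → ℤ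
sum3 (a₁ , a₂ , a₃) = a₁ ℤ.+ a₂ ℤ.+ a₃

Mat3 : Set
Mat3 = Vec3 × Vec3 × Vec3

_·_ : Mat3 → Vec3 → Vec3
(r₁ , r₂ , r₃) · x = (dot r₁ x , dot r₂ x , dot r₃ x)

V3 : Mat3
V3 = ((+ 6 , + 3 , + 2) , (+ 0 , + 3 , + 2) , (+ 0 , + 0 , + 2))

-- its columns v₁ = (6,0,0), v₂ = (3,3,0), v₃ = (2,2,2)
v1 v2 v3 : Vec3
v1 = (+ 6 , + 0 , + 0)
v2 = (+ 3 , + 3 , + 0)
v3 = (+ 2 , + 2 , + 2)

InP : ℤ → Vec3 → Set
InP n (l₁ , l₂ , l₃) =
  (l₁ ℤ.+ l₂ ℤ.+ l₃ ≡ n) × (l₂ ℤ.≤ l₁) × (l₃ ℤ.≤ l₂) × (+ 0 ℤ.< l₃)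

Nonneg : Vec3 → Set
Nonneg (t₁ , t₂ , t₃) = (+ 0 ℤ.≤ t₁) × (+ 0 ℤ.≤ t₂) × (+ 0 ℤ.≤ t₃)

toℚ : ℤ → ℚ
toℚ z = z ℚ./ 1

InF3 : Vec3 → Set
InF3 (m₁ , m₂ , m₃) =
  Σ ℚ λ a → Σ ℚ λ b → Σ ℚ λ c →
    (0ℚ ℚ.≤ a) × (a ℚ.< 1ℚ) × (0ℚ ℚ.≤ b) × (b ℚ.< 1ℚ) × (0ℚ ℚ.< c) × (c ℚ.≤ 1ℚ) ×
    (toℚ m₁ ≡ comb a b c (λ { (x , _ , _) → x })) ×
    (toℚ m₂ ≡ comb a b c (λ { (_ , x , _) → x })) ×
    (toℚ m₃ ≡ comb a b c (λ { (_ , _ , x) → x }))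
  where
  comb : ℚ → ℚ → ℚ → (Vec3 → ℤ) → ℚ
  comb a b c π = a ℚ.* toℚ (π v1) ℚ.+ b ℚ.* toℚ (π v2) ℚ.+ c ℚ.* toℚ (π v3)

InH : ℤ → Vec3 → Set
InH i μ = InF3 μ × (sum3 μ ≡ i)

-- T_k = { v ∈ ℤ³_{≥0} : v₁ + v₂ + v₃ = k }  (empty for k < 0)
InT : ℤ → Vec3 → Set
InT k v = Nonneg v × (sum3 v ≡ k)

InQ : ℤ → ℤ → Vec3 → Vec3 → Set
InQ k r μ τ =
  (InH r μ × InT k τ) ⊎
  (InH (+ 6 ℤ.+ r) μ × InT (k ℤ.- + 1) τ) ⊎
  (InH (+ 12 ℤ.+ r) μ × InT (k ℤ.- + 2) τ)

Decomp : Vec3 → Vec3 → Vec3 → Set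
Decomp l μ τ = InF3 μ × Nonneg τ × (l ≡ μ +v (V3 · τ))

module Submission where

-- Write a partition as λ = (1+a+b+c, 1+a+b, 1+a) with a, b, c ≥ 0. Adding V₃ τ adds
-- (2τ₃, 3τ₂, 6τ₁) to (a, b, c), and the lattice points of F₃ are exactly those with a < 2,
-- b < 3, c < 6; so λ = μ + V₃ τ is division with remainder in each coordinate, which exists
-- and is unique. Every column of V₃ has coordinate sum 6, so |λ| = |μ| + 6|τ|, and since
-- 3 ≤ |μ| ≤ 15 the only possibilities for |λ| = 6k + r are |μ| = 6j + r, |τ| = k − j with
-- j ∈ {0, 1, 2}: these are the three layers of Q_{k,r}.

open import Defs
open import Data.Nat using (ℕ; suc; _+_; _*_; _≤_; _<_; z≤n; s≤s; NonZero)
import Data.Nat.Properties as ℕ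
open import Data.Nat.Properties using (allUpTo?)
open import Data.Nat.DivMod using (_%_; _/_; m≡m%n+[m/n]*n; m%n<n; [m+kn]%n≡m%n; m<n⇒m%n≡m; m<n*o⇒m/o<n)
open import Data.Nat.Coprimality as Coprime using (1-coprimeTo)
open import Data.Nat.Tactic.RingSolver using (solve-∀)
open import Data.Integer as ℤ using (ℤ; +_; +≤+; +<+)
import Data.Integer.Properties as ℤ
open import Data.Integer.Tactic.RingSolver renaming (solve-∀ to ℤ-solve-∀)
open import Data.Rational as ℚ using (ℚ; 0ℚ; 1ℚ; mkℚ)
import Data.Rational.Properties as ℚ
open import Data.Product using (Σ; ∃-syntax; _×_; _,_; proj₁; proj₂)
open import Data.Sum using (inj₁; inj₂)
open import Function using (_∘_)
open import Relation.Binary.PropositionalEquality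
open import Relation.Nullary.Decidable using (Dec; _×-dec_; from-yes)

stair : ℕ → ℕ → ℕ → Vec3
stair a b c = (+ (suc a + b + c) , + (suc a + b) , + suc a)

stair-injective : ∀ {a b c a′ b′ c′} → stair a b c ≡ stair a′ b′ c′ → a ≡ a′ × b ≡ b′ × c ≡ c′
stair-injective {a} {b} {c} {a′} {b′} {c′} eq
  with refl ← ℕ.suc-injective (ℤ.+-injective (cong (proj₂ ∘ proj₂) eq))
  with refl ← ℕ.+-cancelˡ-≡ (suc a) b b′ (ℤ.+-injective (cong (proj₁ ∘ proj₂) eq))
  with refl ← ℕ.+-cancelˡ-≡ (suc a + b) c c′ (ℤ.+-injective (cong proj₁ eq)) = refl , refl , refl

dot-pos : ∀ a b c x y z → dot (+ a , + b , + c) (+ x , + y , + z) ≡ + (a * x + b * y + c * z)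
dot-pos a b c x y z =
  sym (cong₂ ℤ._+_ (cong₂ ℤ._+_ (ℤ.pos-* a x) (ℤ.pos-* b y)) (ℤ.pos-* c z))

stair-+-V3· : ∀ a b c t₁ t₂ t₃ →
              stair a b c +v (V3 · (+ t₁ , + t₂ , + t₃)) ≡ stair (a + t₃ * 2) (b + t₂ * 3) (c + t₁ * 6)
stair-+-V3· a b c t₁ t₂ t₃ =
  cong₂ _,_ (shift (dot-pos 6 3 2 t₁ t₂ t₃) (first a b c t₁ t₂ t₃))
            (cong₂ _,_ (shift (dot-pos 0 3 2 t₁ t₂ t₃) (second a b t₂ t₃))
                       (shift (dot-pos 0 0 2 t₁ t₂ t₃) (third a t₃)))
  where
  shift : ∀ {m x n k} → x ≡ + n → m + n ≡ k → + m ℤ.+ x ≡ + k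
  shift refl refl = refl
  first : ∀ a b c t₁ t₂ t₃ →
          suc a + b + c + (6 * t₁ + 3 * t₂ + 2 * t₃) ≡ suc (a + t₃ * 2) + (b + t₂ * 3) + (c + t₁ * 6)
  first = solve-∀
  second : ∀ a b t₂ t₃ → suc a + b + (3 * t₂ + 2 * t₃) ≡ suc (a + t₃ * 2) + (b + t₂ * 3)
  second = solve-∀
  third : ∀ a t₃ → suc a + 2 * t₃ ≡ suc (a + t₃ * 2)
  third = solve-∀

sum3-+v-V3· : ∀ μ τ → sum3 (μ +v (V3 · τ)) ≡ sum3 μ ℤ.+ + 6 ℤ.* sum3 τ
sum3-+v-V3· (m₁ , m₂ , m₃) (t₁ , t₂ , t₃) = expand m₁ m₂ m₃ t₁ t₂ t₃
  where
  expand : ∀ m₁ m₂ m₃ t₁ t₂ t₃ →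
    m₁ ℤ.+ (+ 6 ℤ.* t₁ ℤ.+ + 3 ℤ.* t₂ ℤ.+ + 2 ℤ.* t₃) ℤ.+
    (m₂ ℤ.+ (+ 0 ℤ.* t₁ ℤ.+ + 3 ℤ.* t₂ ℤ.+ + 2 ℤ.* t₃)) ℤ.+
    (m₃ ℤ.+ (+ 0 ℤ.* t₁ ℤ.+ + 0 ℤ.* t₂ ℤ.+ + 2 ℤ.* t₃))
      ≡ m₁ ℤ.+ m₂ ℤ.+ m₃ ℤ.+ + 6 ℤ.* (t₁ ℤ.+ t₂ ℤ.+ t₃)
  expand = ℤ-solve-∀

-- toℚ z = z / 1 is normalised through a gcd; the literal fraction fromℤ z computes.
fromℤ : ℤ → ℚ
fromℤ z = mkℚ z 0 (Coprime.sym (1-coprimeTo _))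

toℚ≡fromℤ : ∀ z → toℚ z ≡ fromℤ z
toℚ≡fromℤ z = ℚ.↥p/↧p≡p (fromℤ z)

toℚ-cancel-≤ : ∀ {x y} → toℚ x ℚ.≤ toℚ y → x ℤ.≤ y
toℚ-cancel-≤ {x} {y} =
  subst₂ ℤ._≤_ (ℤ.*-identityʳ x) (ℤ.*-identityʳ y) ∘ ℚ.drop-*≤* ∘ subst₂ ℚ._≤_ (toℚ≡fromℤ x) (toℚ≡fromℤ y)

toℚ-cancel-< : ∀ {x y} → toℚ x ℚ.< toℚ y → x ℤ.< y
toℚ-cancel-< {x} {y} =
  subst₂ ℤ._<_ (ℤ.*-identityʳ x) (ℤ.*-identityʳ y) ∘ ℚ.drop-*<* ∘ subst₂ ℚ._<_ (toℚ≡fromℤ x) (toℚ≡fromℤ y)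

toℚ-+ : ∀ x y → toℚ (x ℤ.+ y) ≡ toℚ x ℚ.+ toℚ y
toℚ-+ x y = begin
  toℚ (x ℤ.+ y)                  ≡⟨ cong toℚ (cong₂ ℤ._+_ (ℤ.*-identityʳ x) (ℤ.*-identityʳ y)) ⟨
  toℚ (x ℤ.* + 1 ℤ.+ y ℤ.* + 1)  ≡⟨⟩
  fromℤ x ℚ.+ fromℤ y            ≡⟨ cong₂ ℚ._+_ (toℚ≡fromℤ x) (toℚ≡fromℤ y) ⟨
  toℚ x ℚ.+ toℚ y                ∎
  where open ≡-Reasoning

module _ (q : ℚ) .{{_ : ℚ.Positive q}} where

  0≤a<1⇒0≤a*q<q : ∀ {a} → 0ℚ ℚ.≤ a → a ℚ.< 1ℚ → 0ℚ ℚ.≤ a ℚ.* q × a ℚ.* q ℚ.< q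
  0≤a<1⇒0≤a*q<q {a} 0≤a a<1 =
    subst (ℚ._≤ a ℚ.* q) (ℚ.*-zeroˡ q) (ℚ.*-monoʳ-≤-nonNeg q {{ℚ.pos⇒nonNeg q}} 0≤a) ,
    subst (a ℚ.* q ℚ.<_) (ℚ.*-identityˡ q) (ℚ.*-monoˡ-<-pos q a<1)

  0<c≤1⇒0<c*q≤q : ∀ {c} → 0ℚ ℚ.< c → c ℚ.≤ 1ℚ → 0ℚ ℚ.< c ℚ.* q × c ℚ.* q ℚ.≤ q
  0<c≤1⇒0<c*q≤q {c} 0<c c≤1 =
    subst (ℚ._< c ℚ.* q) (ℚ.*-zeroˡ q) (ℚ.*-monoˡ-<-pos q 0<c) ,
    subst (c ℚ.* q ℚ.≤_) (ℚ.*-identityˡ q) (ℚ.*-monoʳ-≤-nonNeg q {{ℚ.pos⇒nonNeg q}} c≤1)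

cancel-0<x≤n : ∀ {x : ℤ} {p : ℚ} n → toℚ x ≡ p → 0ℚ ℚ.< p × p ℚ.≤ toℚ (+ n) → + 0 ℤ.< x × x ℤ.≤ + n
cancel-0<x≤n n x≡p (0<p , p≤n) =
  toℚ-cancel-< (subst (0ℚ ℚ.<_) (sym x≡p) 0<p) , toℚ-cancel-≤ (subst (ℚ._≤ toℚ (+ n)) (sym x≡p) p≤n)

cancel-y≤x<n+y : ∀ {x y : ℤ} {p : ℚ} n → toℚ x ≡ p ℚ.+ toℚ y → 0ℚ ℚ.≤ p × p ℚ.< toℚ (+ n) →
                 y ℤ.≤ x × x ℤ.< + n ℤ.+ y
cancel-y≤x<n+y {x} {y} n x≡p+y (0≤p , p<n) =
  toℚ-cancel-≤ (subst₂ ℚ._≤_ (ℚ.+-identityˡ (toℚ y)) (sym x≡p+y) (ℚ.+-monoˡ-≤ (toℚ y) 0≤p)) ,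
  toℚ-cancel-< (subst₂ ℚ._<_ (sym x≡p+y) (sym (toℚ-+ (+ n) y)) (ℚ.+-monoˡ-< (toℚ y) p<n))

-- The lattice points of F₃, in the coordinates of stair.
data Fundamental : Vec3 → Set where
  fundamental : ∀ {a b c} → a < 2 → b < 3 → c < 6 → Fundamental (stair a b c)

bounded-gap : ∀ {m} d {n : ℤ} → + m ℤ.≤ n → n ℤ.< + d ℤ.+ + m → ∃[ e ] e < d × n ≡ + (m + e)
bounded-gap {m} d (+≤+ m≤n) (+<+ n<d+m) with e , refl ← ℕ.m≤n⇒∃[o]m+o≡n m≤n =
  e , ℕ.+-cancelˡ-< m e d (subst (m + e <_) (ℕ.+-comm d m) n<d+m) , refl

bounds⇒Fundamental : ∀ {m₁ m₂ m₃} → + 0 ℤ.< m₃ × m₃ ℤ.≤ + 2 → m₃ ℤ.≤ m₂ × m₂ ℤ.< + 3 ℤ.+ m₃ →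
                     m₂ ℤ.≤ m₁ × m₁ ℤ.< + 6 ℤ.+ m₂ → Fundamental (m₁ , m₂ , m₃)
bounds⇒Fundamental (+<+ {n = suc a} _ , +≤+ (s≤s a≤1)) (m₃≤m₂ , m₂<3+m₃) (m₂≤m₁ , m₁<6+m₂)
  with b , b<3 , refl ← bounded-gap 3 m₃≤m₂ m₂<3+m₃
  with c , c<6 , refl ← bounded-gap 6 m₂≤m₁ m₁<6+m₂ = fundamental (s≤s a≤1) b<3 c<6

InF3⇒Fundamental : ∀ μ → InF3 μ → Fundamental μ
InF3⇒Fundamental (m₁ , m₂ , m₃) (α , β , γ , 0≤α , α<1 , 0≤β , β<1 , 0<γ , γ≤1 , e₁ , e₂ , e₃) =
  bounds⇒Fundamental (cancel-0<x≤n 2 m₃≡2γ (0<c≤1⇒0<c*q≤q two 0<γ γ≤1))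
                     (cancel-y≤x<n+y 3 m₂≡3β+m₃ (0≤a<1⇒0≤a*q<q three 0≤β β<1))
                     (cancel-y≤x<n+y 6 m₁≡6α+m₂ (0≤a<1⇒0≤a*q<q six 0≤α α<1))
  where
  open ≡-Reasoning
  two three six : ℚ
  two = toℚ (+ 2)
  three = toℚ (+ 3)
  six = toℚ (+ 6)

  m₃≡2γ : toℚ m₃ ≡ γ ℚ.* two
  m₃≡2γ = begin
    toℚ m₃                                     ≡⟨ e₃ ⟩
    α ℚ.* 0ℚ ℚ.+ β ℚ.* 0ℚ ℚ.+ γ ℚ.* two
      ≡⟨ cong₂ (λ u v → u ℚ.+ v ℚ.+ γ ℚ.* two) (ℚ.*-zeroʳ α) (ℚ.*-zeroʳ β) ⟩
    0ℚ ℚ.+ 0ℚ ℚ.+ γ ℚ.* two                    ≡⟨ ℚ.+-identityˡ (γ ℚ.* two) ⟩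
    γ ℚ.* two                                  ∎

  m₂≡3β+m₃ : toℚ m₂ ≡ β ℚ.* three ℚ.+ toℚ m₃
  m₂≡3β+m₃ = begin
    toℚ m₂                                     ≡⟨ e₂ ⟩
    α ℚ.* 0ℚ ℚ.+ β ℚ.* three ℚ.+ γ ℚ.* two
      ≡⟨ cong (λ u → u ℚ.+ β ℚ.* three ℚ.+ γ ℚ.* two) (ℚ.*-zeroʳ α) ⟩
    0ℚ ℚ.+ β ℚ.* three ℚ.+ γ ℚ.* two           ≡⟨ cong₂ ℚ._+_ (ℚ.+-identityˡ (β ℚ.* three)) (sym m₃≡2γ) ⟩
    β ℚ.* three ℚ.+ toℚ m₃                     ∎

  m₁≡6α+m₂ : toℚ m₁ ≡ α ℚ.* six ℚ.+ toℚ m₂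
  m₁≡6α+m₂ = begin
    toℚ m₁                                     ≡⟨ e₁ ⟩
    α ℚ.* six ℚ.+ β ℚ.* three ℚ.+ γ ℚ.* two    ≡⟨ ℚ.+-assoc (α ℚ.* six) (β ℚ.* three) (γ ℚ.* two) ⟩
    α ℚ.* six ℚ.+ (β ℚ.* three ℚ.+ γ ℚ.* two)
      ≡⟨ cong (λ u → α ℚ.* six ℚ.+ (β ℚ.* three ℚ.+ u)) m₃≡2γ ⟨
    α ℚ.* six ℚ.+ (β ℚ.* three ℚ.+ toℚ m₃)     ≡⟨ cong (α ℚ.* six ℚ.+_) (sym m₂≡3β+m₃) ⟩
    α ℚ.* six ℚ.+ toℚ m₂                       ∎

InF3-at : ℚ → ℚ → ℚ → Vec3 → Set
InF3-at α β γ (m₁ , m₂ , m₃) =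
  (0ℚ ℚ.≤ α) × (α ℚ.< 1ℚ) × (0ℚ ℚ.≤ β) × (β ℚ.< 1ℚ) × (0ℚ ℚ.< γ) × (γ ℚ.≤ 1ℚ) ×
  (toℚ m₁ ≡ α ℚ.* toℚ (+ 6) ℚ.+ β ℚ.* toℚ (+ 3) ℚ.+ γ ℚ.* toℚ (+ 2)) ×
  (toℚ m₂ ≡ α ℚ.* toℚ (+ 0) ℚ.+ β ℚ.* toℚ (+ 3) ℚ.+ γ ℚ.* toℚ (+ 2)) ×
  (toℚ m₃ ≡ α ℚ.* toℚ (+ 0) ℚ.+ β ℚ.* toℚ (+ 0) ℚ.+ γ ℚ.* toℚ (+ 2))

InF3-at? : ∀ α β γ μ → Dec (InF3-at α β γ μ)
InF3-at? α β γ (m₁ , m₂ , m₃) =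
  0ℚ ℚ.≤? α ×-dec α ℚ.<? 1ℚ ×-dec 0ℚ ℚ.≤? β ×-dec β ℚ.<? 1ℚ ×-dec 0ℚ ℚ.<? γ ×-dec γ ℚ.≤? 1ℚ ×-dec
  toℚ m₁ ℚ.≟ _ ×-dec toℚ m₂ ℚ.≟ _ ×-dec toℚ m₃ ℚ.≟ _

-- stair a b c = (c/6) v₁ + (b/3) v₂ + ((a+1)/2) v₃, checked at each of the 36 points.
stair∈F3 : ∀ {a b c} → a < 2 → b < 3 → c < 6 → InF3 (stair a b c)
stair∈F3 {a} {b} {c} a<2 b<3 c<6 =
  + c ℚ./ 6 , + b ℚ./ 3 , + suc a ℚ./ 2 ,
  from-yes (allUpTo? (λ a → allUpTo? (λ b → allUpTo? (λ c →
    InF3-at? (+ c ℚ./ 6) (+ b ℚ./ 3) (+ suc a ℚ./ 2) (stair a b c)) 6) 3) 2) a<2 b<3 c<6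

InP⇒stair : ∀ {n l} → InP n l → ∃[ a ] ∃[ b ] ∃[ c ] l ≡ stair a b c
InP⇒stair (_ , +≤+ l₂≤l₁ , +≤+ l₃≤l₂ , +<+ {n = suc a} _)
  with b , refl ← ℕ.m≤n⇒∃[o]m+o≡n l₃≤l₂
  with c , refl ← ℕ.m≤n⇒∃[o]m+o≡n l₂≤l₁ = a , b , c , refl

stair∈P : ∀ {n} a b c → sum3 (stair a b c) ≡ n → InP n (stair a b c)
stair∈P a b c Σ≡n = Σ≡n , +≤+ (ℕ.m≤m+n (suc a + b) c) , +≤+ (ℕ.m≤m+n (suc a) b) , +<+ (s≤s z≤n)

decomposition∈P : ∀ {n} μ τ → InF3 μ → Nonneg τ → sum3 (μ +v (V3 · τ)) ≡ n → InP n (μ +v (V3 · τ))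
decomposition∈P {n} μ τ μ∈F3 (+≤+ {n = t₁} _ , +≤+ {n = t₂} _ , +≤+ {n = t₃} _) Σ≡n
  with fundamental {a} {b} {c} _ _ _ ← InF3⇒Fundamental μ μ∈F3 =
  subst (InP n) (sym l≡stair) (stair∈P _ _ _ (trans (cong sum3 (sym l≡stair)) Σ≡n))
  where
  l≡stair : stair a b c +v (V3 · (+ t₁ , + t₂ , + t₃)) ≡ stair (a + t₃ * 2) (b + t₂ * 3) (c + t₁ * 6)
  l≡stair = stair-+-V3· a b c t₁ t₂ t₃

Fundamental⇒sum3<18 : ∀ {μ} → Fundamental μ → ∃[ s ] s < 18 × sum3 μ ≡ + s
Fundamental⇒sum3<18 (fundamental {a} {b} {c} a<2 b<3 c<6) =
  _ , s≤s (ℕ.≤-trans sum≤15 (ℕ.m≤m+n 15 2)) , refl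
  where
  b≤2 : b ≤ 2
  b≤2 = ℕ.≤-pred b<3
  sum≤15 : suc a + b + c + (suc a + b) + suc a ≤ 15
  sum≤15 =
    ℕ.+-mono-≤ (ℕ.+-mono-≤ (ℕ.+-mono-≤ (ℕ.+-mono-≤ a<2 b≤2) (ℕ.≤-pred c<6)) (ℕ.+-mono-≤ a<2 b≤2)) a<2

module _ {d : ℕ} .{{_ : NonZero d}} where

  divMod-unique : ∀ {n r q} → r < d → n ≡ r + q * d → n % d ≡ r × n / d ≡ q
  divMod-unique {n} {r} {q} r<d refl = n%d≡r , ℕ.*-cancelʳ-≡ (n / d) q d (ℕ.+-cancelˡ-≡ r _ _ (begin
    r + n / d * d      ≡⟨ cong (_+ n / d * d) n%d≡r ⟨
    n % d + n / d * d  ≡⟨ m≡m%n+[m/n]*n n d ⟨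
    r + q * d          ∎))
    where
    open ≡-Reasoning
    n%d≡r : n % d ≡ r
    n%d≡r = trans ([m+kn]%n≡m%n r q d) (m<n⇒m%n≡m r<d)

  carry : ∀ {s t k r} → r < d → s + d * t ≡ d * k + r → s ≡ d * (s / d) + r × s / d + t ≡ k
  carry {s} {t} {k} {r} r<d eq =
    trans (m≡m%n+[m/n]*n s d) (trans (cong (_+ s / d * d) s%d≡r) (swap′ r (s / d) d)) ,
    trans (sym (proj₂ via-s)) (proj₂ via-k)
    where
    regroup : ∀ x j d t → x + j * d + d * t ≡ x + (j + t) * d
    regroup = solve-∀
    swap : ∀ d k r → d * k + r ≡ r + k * d
    swap = solve-∀
    swap′ : ∀ r j d → r + j * d ≡ d * j + r
    swap′ = solve-∀
    n : ℕ
    n = s + d * t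
    via-s : n % d ≡ s % d × n / d ≡ s / d + t
    via-s = divMod-unique (m%n<n s d)
              (trans (cong (_+ d * t) (m≡m%n+[m/n]*n s d)) (regroup (s % d) (s / d) d t))
    via-k : n % d ≡ r × n / d ≡ k
    via-k = divMod-unique r<d (trans eq (swap d k r))
    s%d≡r : s % d ≡ r
    s%d≡r = trans (sym (proj₁ via-s)) (proj₁ via-k)

decompose : ∀ a b c →
            Decomp (stair a b c) (stair (a % 2) (b % 3) (c % 6)) (+ (c / 6) , + (b / 3) , + (a / 2))
decompose a b c =
  stair∈F3 (m%n<n a 2) (m%n<n b 3) (m%n<n c 6) , (+≤+ z≤n , +≤+ z≤n , +≤+ z≤n) ,
  regroup (a % 2) (b % 3) (c % 6) (c / 6) (b / 3) (a / 2)
          (m≡m%n+[m/n]*n a 2) (m≡m%n+[m/n]*n b 3) (m≡m%n+[m/n]*n c 6)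
  where
  regroup : ∀ {a b c} a₀ b₀ c₀ q₁ q₂ q₃ → a ≡ a₀ + q₃ * 2 → b ≡ b₀ + q₂ * 3 → c ≡ c₀ + q₁ * 6 →
            stair a b c ≡ stair a₀ b₀ c₀ +v (V3 · (+ q₁ , + q₂ , + q₃))
  regroup a₀ b₀ c₀ q₁ q₂ q₃ refl refl refl = sym (stair-+-V3· a₀ b₀ c₀ q₁ q₂ q₃)

decompose-unique : ∀ {a b c μ τ} → Decomp (stair a b c) μ τ →
                   μ ≡ stair (a % 2) (b % 3) (c % 6) × τ ≡ (+ (c / 6) , + (b / 3) , + (a / 2))
decompose-unique {μ = μ} (μ∈F3 , (+≤+ {n = t₁} _ , +≤+ {n = t₂} _ , +≤+ {n = t₃} _) , eq)
  with fundamental {a′} {b′} {c′} a′<2 b′<3 c′<6 ← InF3⇒Fundamental μ μ∈F3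
  with a≡ , b≡ , c≡ ← stair-injective (trans eq (stair-+-V3· a′ b′ c′ t₁ t₂ t₃))
  with refl , refl ← divMod-unique {q = t₃} a′<2 a≡
  with refl , refl ← divMod-unique {q = t₂} b′<3 b≡
  with refl , refl ← divMod-unique {q = t₁} c′<6 c≡ = refl , refl

unique-decomposition : ∀ {n l} → InP n l →
  Σ Vec3 λ μ → Σ Vec3 λ τ → Decomp l μ τ × (∀ μ′ τ′ → Decomp l μ′ τ′ → μ′ ≡ μ × τ′ ≡ τ)
unique-decomposition l∈P with a , b , c , refl ← InP⇒stair l∈P =
  _ , _ , decompose a b c , λ _ _ → decompose-unique

pos-difference : ∀ {j t k} → j + t ≡ k → + t ≡ + k ℤ.- + j
pos-difference {j} {t} refl = sym (trans (cong (ℤ._- + j) (ℤ.pos-+ j t)) (cancel (+ j) (+ t)))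
  where
  cancel : ∀ x y → x ℤ.+ y ℤ.- x ≡ y
  cancel = ℤ-solve-∀

InQ-layer : ∀ {k r} μ τ j → j < 3 → InF3 μ → Nonneg τ →
            sum3 μ ≡ + (6 * j + r) → sum3 τ ≡ + k ℤ.- + j → InQ (+ k) (+ r) μ τ
InQ-layer {k} _ _ 0 _ μ∈F3 τ≥0 Σμ Στ = inj₁ ((μ∈F3 , Σμ) , τ≥0 , trans Στ (cong +_ (ℕ.+-identityʳ k)))
InQ-layer _ _ 1 _ μ∈F3 τ≥0 Σμ Στ = inj₂ (inj₁ ((μ∈F3 , Σμ) , τ≥0 , Στ))
InQ-layer _ _ 2 _ μ∈F3 τ≥0 Σμ Στ = inj₂ (inj₂ ((μ∈F3 , Σμ) , τ≥0 , Στ))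
InQ-layer _ _ (suc (suc (suc _))) (s≤s (s≤s (s≤s ())))

Decomp⇒InQ : ∀ {k r l} μ τ → r < 6 → InP (+ 6 ℤ.* + k ℤ.+ + r) l → Decomp l μ τ → InQ (+ k) (+ r) μ τ
Decomp⇒InQ {k} {r} μ τ r<6 (Σl , _)
           (μ∈F3 , τ≥0@(+≤+ {n = t₁} _ , +≤+ {n = t₂} _ , +≤+ {n = t₃} _) , refl)
  with s , s<18 , Σμ ← Fundamental⇒sum3<18 (InF3⇒Fundamental μ μ∈F3) =
  InQ-layer μ τ (s / 6) (m<n*o⇒m/o<n s<18) μ∈F3 τ≥0
    (trans Σμ (cong +_ (proj₁ split))) (pos-difference {s / 6} (proj₂ split))
  where
  open ≡-Reasoning
  sizes : s + 6 * (t₁ + t₂ + t₃) ≡ 6 * k + r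
  sizes = ℤ.+-injective (begin
    + s ℤ.+ + (6 * (t₁ + t₂ + t₃))       ≡⟨ cong (ℤ._+_ (+ s)) (ℤ.pos-* 6 (t₁ + t₂ + t₃)) ⟩
    + s ℤ.+ + 6 ℤ.* sum3 τ               ≡⟨ cong (ℤ._+ + 6 ℤ.* sum3 τ) Σμ ⟨
    sum3 μ ℤ.+ + 6 ℤ.* sum3 τ            ≡⟨ sum3-+v-V3· μ τ ⟨
    sum3 (μ +v (V3 · τ))                 ≡⟨ Σl ⟩
    + 6 ℤ.* + k ℤ.+ + r                  ≡⟨ cong (ℤ._+ + r) (ℤ.pos-* 6 k) ⟨
    + (6 * k) ℤ.+ + r                    ∎)
  split : s ≡ 6 * (s / 6) + r × s / 6 + (t₁ + t₂ + t₃) ≡ k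
  split = carry {s = s} {t₁ + t₂ + t₃} {k} {r} r<6 sizes

layer-sum : ∀ k r j → + 6 ℤ.* j ℤ.+ r ℤ.+ + 6 ℤ.* (k ℤ.- j) ≡ + 6 ℤ.* k ℤ.+ r
layer-sum = ℤ-solve-∀

InQ⇒sums : ∀ {k r} μ τ → InQ (+ k) (+ r) μ τ →
           InF3 μ × Nonneg τ × sum3 μ ℤ.+ + 6 ℤ.* sum3 τ ≡ + 6 ℤ.* + k ℤ.+ + r
InQ⇒sums {k} {r} _ _ (inj₁ ((μ∈F3 , Σμ) , τ≥0 , Στ)) =
  μ∈F3 , τ≥0 , trans (cong₂ (λ x y → x ℤ.+ + 6 ℤ.* y) Σμ Στ) (ℤ.+-comm (+ r) (+ 6 ℤ.* + k))
InQ⇒sums {k} {r} _ _ (inj₂ (inj₁ ((μ∈F3 , Σμ) , τ≥0 , Στ))) =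
  μ∈F3 , τ≥0 , trans (cong₂ (λ x y → x ℤ.+ + 6 ℤ.* y) Σμ Στ) (layer-sum (+ k) (+ r) (+ 1))
InQ⇒sums {k} {r} _ _ (inj₂ (inj₂ ((μ∈F3 , Σμ) , τ≥0 , Στ))) =
  μ∈F3 , τ≥0 , trans (cong₂ (λ x y → x ℤ.+ + 6 ℤ.* y) Σμ Στ) (layer-sum (+ k) (+ r) (+ 2))

InQ⇒preimage : ∀ {k r} μ τ → InQ (+ k) (+ r) μ τ →
               InP (+ 6 ℤ.* + k ℤ.+ + r) (μ +v (V3 · τ)) × Decomp (μ +v (V3 · τ)) μ τ
InQ⇒preimage μ τ μτ∈Q with μ∈F3 , τ≥0 , Σ≡ ← InQ⇒sums μ τ μτ∈Q =
  decomposition∈P μ τ μ∈F3 τ≥0 (trans (sum3-+v-V3· μ τ) Σ≡) , μ∈F3 , τ≥0 , refl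

lemma1 : (k r : ℕ) → r ≤ 5 →
    ((l : Vec3) → InP (+ 6 ℤ.* + k ℤ.+ + r) l →
      Σ Vec3 (λ μ → Σ Vec3 (λ τ → Decomp l μ τ ×
        ((μ′ τ′ : Vec3) → Decomp l μ′ τ′ → (μ′ ≡ μ) × (τ′ ≡ τ))))) ×
    ((l μ τ : Vec3) → InP (+ 6 ℤ.* + k ℤ.+ + r) l → Decomp l μ τ → InQ (+ k) (+ r) μ τ) ×
    ((l l′ μ τ : Vec3) → InP (+ 6 ℤ.* + k ℤ.+ + r) l → InP (+ 6 ℤ.* + k ℤ.+ + r) l′ →
      Decomp l μ τ → Decomp l′ μ τ → l ≡ l′) ×
    ((μ τ : Vec3) → InQ (+ k) (+ r) μ τ →
      Σ Vec3 (λ l → InP (+ 6 ℤ.* + k ℤ.+ + r) l × Decomp l μ τ))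
lemma1 k r r≤5 =
  (λ _ → unique-decomposition) ,
  (λ _ μ τ → Decomp⇒InQ μ τ (s≤s r≤5)) ,
  (λ { _ _ _ _ _ _ (_ , _ , l≡) (_ , _ , l′≡) → trans l≡ (sym l′≡) }) ,
  (λ μ τ μτ∈Q → μ +v (V3 · τ) , InQ⇒preimage μ τ μτ∈Q)
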